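{- Let $p>10$ be a prime and let $\#N_p(4)$ be the number of quadratic non-residues modulo $p$ among the integers in $(p/8,p/4)\cup(3p/8,p/2)$. Then $$(-1)^{\#N_p(4)}=\begin{cases}1 & p=1+8k,\\ -1 & p=5+8k,\\ (-1)^k & p=3+8k,\\ (-1)^{k+1} & p=7+8k,\end{cases}$$ where $k\in\mathbb Z_{\ge0}$. -}

module Defs where

open import Data.Nat using (ℕ; zero; suc; _+_; _*_; _<_; _%_; NonZero)
open import Data.Nat.Properties using (_≟_; _<?_)
open import Data.Nat.Divisibility using (_∣_; _∣?_)
open import Data.Nat.Primality using (Prime)
open import Data.Integer using (ℤ; -_; +_)
open import Data.List using (List; upTo; filter; length)
open import Data.Empty using (⊥)
open import Data.Sum using (_⊎_; inj₁; inj₂)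
open import Data.Nat.Properties using (n<1+n; m<n⇒m<1+n; m<1+n⇒m<n∨m≡n)
open import Data.Product using (∃; _×_; _,_; proj₁; proj₂)
open import Relation.Nullary using (Dec; yes; no; ¬_)
open import Relation.Nullary.Decidable using (_×-dec_; _⊎-dec_; ¬?)
open import Relation.Binary.PropositionalEquality using (_≡_; refl; sym; trans; cong)
open import Data.Nat.DivMod using (%-distribˡ-*; m%n%n≡m%n; [m+kn]%n≡m%n; m%n<n)

QR : (p : ℕ) .{{_ : NonZero p}} → ℕ → Set
QR p a = ∃ λ x → (x * x) % p ≡ a % p

NonResidue : (p : ℕ) .{{_ : NonZero p}} → ℕ → Set
NonResidue p a = ¬ (p ∣ a) × ¬ QR p a

-- deciding QR by searching witnesses x < p (any x reduces to x % p < p)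
private
  reduce : (p : ℕ) .{{_ : NonZero p}} (x : ℕ) → ((x % p) * (x % p)) % p ≡ (x * x) % p
  reduce p x = sym (%-distribˡ-* x x p)

  search : (p : ℕ) .{{_ : NonZero p}} (a n : ℕ) →
           Dec (∃ λ x → x < n × (x * x) % p ≡ a % p)
  search p a zero = no λ { (x , () , _) }
  search p a (suc n) with (n * n) % p ≟ a % p
  ... | yes e = yes (n , n<1+n n , e)
  ... | no ne with search p a n
  ...   | yes (x , x<n , e) = yes (x , m<n⇒m<1+n x<n , e)
  ...   | no nx = no λ { (x , x<1+n , e) → helper x x<1+n e }
    where
    helper : ∀ x → x < suc n → (x * x) % p ≡ a % p → ⊥
    helper x x<1+n e with m<1+n⇒m<n∨m≡n x<1+n
    ... | inj₁ x<n = nx (x , x<n , e)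
    ... | inj₂ refl = ne e

qr? : (p : ℕ) .{{_ : NonZero p}} (a : ℕ) → Dec (QR p a)
qr? p a with search p a p
... | yes (x , _ , e) = yes (x , e)
... | no nx = no λ { (x , e) → nx (x % p , m%n<n x p , trans (reduce p x) e) }

nonResidue? : (p : ℕ) .{{_ : NonZero p}} (a : ℕ) → Dec (NonResidue p a)
nonResidue? p a = ¬? (p ∣? a) ×-dec ¬? (qr? p a)

-- a lies in the real interval (p/8, p/4) ∪ (3p/8, p/2), written with integer arithmetic
InRange : ℕ → ℕ → Set
InRange p a = (p < 8 * a × 4 * a < p) ⊎ (3 * p < 8 * a × 2 * a < p)

inRange? : (p a : ℕ) → Dec (InRange p a)
inRange? p a = ((p <? 8 * a) ×-dec (4 * a <? p)) ⊎-dec ((3 * p <? 8 * a) ×-dec (2 * a <? p))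

-- #N_p(4): number of quadratic non-residues mod p among the integers in
-- (p/8,p/4) ∪ (3p/8,p/2); all such integers lie in [0, p), so we enumerate upTo p.
#N4 : (p : ℕ) .{{_ : NonZero p}} → ℕ
#N4 p = length (filter (nonResidue? p) (filter (inRange? p) (upTo p)))

neg1^ : ℕ → ℤ
neg1^ zero = + 1
neg1^ (suc n) = - neg1^ n

-- By Euler's criterion (-1)^#N ≡ ∏ a^h (mod p), where h = (p − 1)/2 and a runs over the
-- integers of (p/8, p/4) ∪ (3p/8, p/2).  These form two blocks of equal length m, namely
-- k+1, …, k+m and h−m+1, …, h.  Since 2j + 1 ≡ −2(h − j) (mod p), splitting (k + m)! into
-- its even and odd factors gives
--   (k+1)⋯(k+m) ≡ 2^k (−2)^m · h(h−1)⋯(h−m+1)   (mod p),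
-- so the product of the two blocks is 2^k (−2)^m times a square, and its h-th power is
-- (−1)^(mh) (2^h)^(k+m).  The same identity for k + m = h gives 2^h ≡ (−1)^⌈h/2⌉.  What is
-- left is the parity of the exponent in each residue class of p modulo 8.
module Submission where

open import Function using (_∘_; id)
open import Data.Nat as ℕ using (ℕ; zero; suc; _≤_; _<_; _∸_; z≤n; s≤s; z<s; s<s; NonZero)
import Data.Nat.Properties as ℕₚ
open import Data.Nat.Primality using (Prime; prime⇒nonZero; prime⇒nonTrivial; euclidsLemma)
open import Data.Product using (∃-syntax; _×_; _,_; proj₁; proj₂)
open import Data.Sum as Sum using (_⊎_; inj₁; inj₂; [_,_]′)
open import Data.Empty using (⊥-elim)
open import Data.List using (List; []; _∷_; _++_; length; filter; applyUpTo; upTo)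
open import Data.List.Properties
  using (filter-all; filter-none; filter-accept; filter-reject; filter-++; length-++; length-applyUpTo;
         ++-identityʳ)
open import Data.List.Membership.Propositional using (_∈_)
open import Data.List.Membership.Propositional.Properties
  using (∈-filter⁺; ∈-filter⁻; ∈-applyUpTo⁺; ∈-applyUpTo⁻)
open import Data.List.Relation.Unary.All as All using (All)
open import Data.List.Relation.Unary.All.Properties using (applyUpTo⁺₁)
open import Data.List.Relation.Unary.Any using (here; there)
open import Data.List.Relation.Unary.AllPairs using (_∷_)
open import Data.List.Relation.Unary.Unique.Propositional using (Unique)
import Data.List.Relation.Unary.Unique.Propositional.Properties as Unique
open import Data.List.Relation.Binary.Permutation.Propositional
  using (_↭_; ↭-refl; ↭-prep; ↭-swap; ↭-trans; ↭-reflexive)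
open import Data.List.Relation.Binary.Permutation.Propositional.Properties using (↭-length)
open import Data.Nat.ListAction using (product)
open import Data.Nat.ListAction.Properties using (product-↭)
open import Level using (0ℓ)
open import Relation.Nullary using (¬_; ¬?; Dec; yes; no)
open import Relation.Unary using (Pred; Decidable)
open import Relation.Binary.PropositionalEquality
  using (_≡_; _≢_; refl; sym; trans; cong; cong₂; subst; subst₂; module ≡-Reasoning)

open import Defs

_≢?_ : ∀ z y → Dec (z ≢ y)
z ≢? y = ¬? (z ℕ.≟ y)

infixl 6 _without_
_without_ : List ℕ → ℕ → List ℕ
xs without y = filter (_≢? y) xs

∈-without⁻ : ∀ {xs y z} → z ∈ xs without y → z ∈ xs × z ≢ y
∈-without⁻ {y = y} = ∈-filter⁻ (_≢? y)

∈-without⁺ : ∀ {xs y z} → z ∈ xs → z ≢ y → z ∈ xs without y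
∈-without⁺ {y = y} = ∈-filter⁺ (_≢? y)

without-unique : ∀ {xs} y → Unique xs → Unique (xs without y)
without-unique y = Unique.filter⁺ (_≢? y)

↭-without : ∀ {xs y} → Unique xs → y ∈ xs → xs ↭ y ∷ xs without y
↭-without {x ∷ xs} {y} (x∉xs ∷ uniq) y∈x∷xs with x ℕ.≟ y | y∈x∷xs
... | yes refl | _ = ↭-reflexive (cong (x ∷_) (sym (begin
  (x ∷ xs) without x  ≡⟨ filter-reject (_≢? x) (λ x≢x → x≢x refl) ⟩
  xs without x        ≡⟨ filter-all (_≢? x) (All.map (λ x≢z z≡x → x≢z (sym z≡x)) x∉xs) ⟩
  xs                  ∎)))
  where open ≡-Reasoning
... | no x≢y | here y≡x   = ⊥-elim (x≢y (sym y≡x))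
... | no x≢y | there y∈xs = ↭-trans (↭-prep x (↭-without uniq y∈xs))
                              (↭-trans (↭-swap x y ↭-refl)
                                       (↭-reflexive (cong (y ∷_) (sym (filter-accept (_≢? y) x≢y)))))

halve-2+ : ∀ n {l} → n ℕ.+ n ≡ suc (suc l) → ∃[ m ] n ≡ suc m × l ≡ m ℕ.+ m
halve-2+ (suc m) eq =
  m , refl , sym (ℕₚ.suc-injective (trans (sym (ℕₚ.+-suc m m)) (ℕₚ.suc-injective eq)))

-- k = ⌊n/2⌋ and m = ⌈n/2⌉ for n = k + m
Halves : ℕ → ℕ → Set
Halves k m = m ≡ k ⊎ m ≡ suc k

module IntegerIdentities where

  open import Data.Integer using (ℤ; +_; -_; _*_; _^_; 1ℤ; -1ℤ)
  open import Data.Integer.Properties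
    using (*-comm; *-assoc; *-identityˡ; *-identityʳ; *-commutativeSemigroup; ^-*-assoc;
           ^-distribˡ-+-*; pos-*; neg-distribˡ-*; neg-involutive)
  open import Algebra.Properties.CommutativeSemigroup *-commutativeSemigroup
    using (interchange; x∙yz≈y∙xz)
  open import Data.Integer.Tactic.RingSolver using (solve-∀)
  open ≡-Reasoning

  2ℤ : ℤ
  2ℤ = + 2

  ∏ : ℕ → (ℕ → ℤ) → ℤ
  ∏ zero    f = 1ℤ
  ∏ (suc n) f = f 0 * ∏ n (f ∘ suc)

  infixl 10 ∏
  syntax ∏ n (λ i → e) = ∏[ i < n ] e

  ∏-cong : ∀ n {f g : ℕ → ℤ} → (∀ {i} → i < n → f i ≡ g i) → ∏ n f ≡ ∏ n g
  ∏-cong zero    f≡g = refl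
  ∏-cong (suc n) f≡g = cong₂ _*_ (f≡g z<s) (∏-cong n (f≡g ∘ s<s))

  ∏-distrib-* : ∀ n (f g : ℕ → ℤ) → ∏[ i < n ] (f i * g i) ≡ ∏ n f * ∏ n g
  ∏-distrib-* zero    f g = refl
  ∏-distrib-* (suc n) f g =
    trans (cong (f 0 * g 0 *_) (∏-distrib-* n (f ∘ suc) (g ∘ suc))) (interchange (f 0) (g 0) _ _)

  ∏-const : ∀ n c → ∏[ i < n ] c ≡ c ^ n
  ∏-const zero    c = refl
  ∏-const (suc n) c = cong (c *_) (∏-const n c)

  ∏-+ : ∀ m n (f : ℕ → ℤ) → ∏ (m ℕ.+ n) f ≡ ∏ m f * ∏[ i < n ] f (m ℕ.+ i)
  ∏-+ zero    n f = sym (*-identityˡ _)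
  ∏-+ (suc m) n f = trans (cong (f 0 *_) (∏-+ m n (f ∘ suc))) (sym (*-assoc (f 0) _ _))

  ∏-suc : ∀ n (f : ℕ → ℤ) → ∏ (suc n) f ≡ ∏ n f * f n
  ∏-suc zero    f = trans (*-identityʳ (f 0)) (sym (*-identityˡ (f 0)))
  ∏-suc (suc n) f = trans (cong (f 0 *_) (∏-suc n (f ∘ suc))) (sym (*-assoc (f 0) _ _))

  ∏-reverse : ∀ n (f : ℕ → ℤ) → ∏ n f ≡ ∏[ i < n ] f (n ∸ suc i)
  ∏-reverse zero    f = refl
  ∏-reverse (suc n) f = begin
    ∏ (suc n) f                     ≡⟨ ∏-suc n f ⟩
    ∏ n f * f n                     ≡⟨ cong (_* f n) (∏-reverse n f) ⟩
    ∏[ i < n ] f (n ∸ suc i) * f n  ≡⟨ *-comm _ (f n) ⟩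
    f n * ∏[ i < n ] f (n ∸ suc i)  ∎

  ∏-evens-odds : ∀ n (f : ℕ → ℤ) →
                 ∏ (n ℕ.+ n) f ≡ ∏[ j < n ] f (2 ℕ.* j) * ∏[ j < n ] f (suc (2 ℕ.* j))
  ∏-evens-odds zero    f = refl
  ∏-evens-odds (suc n) f = begin
    f 0 * ∏ (n ℕ.+ suc n) (f ∘ suc)
      ≡⟨ cong (λ t → f 0 * ∏ t (f ∘ suc)) (ℕₚ.+-suc n n) ⟩
    f 0 * (f 1 * ∏ (n ℕ.+ n) (f ∘ suc ∘ suc))
      ≡⟨ cong (λ t → f 0 * (f 1 * t)) (∏-evens-odds n (f ∘ suc ∘ suc)) ⟩
    f 0 * (f 1 * (E * O))
      ≡⟨ shuffle (f 0) (f 1) E O ⟩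
    f 0 * E * (f 1 * O)
      ≡⟨ cong₂ (λ e o → f 0 * e * (f 1 * o)) (∏-cong n λ {j} _ → cong f (2+2j j))
                                             (∏-cong n λ {j} _ → cong (f ∘ suc) (2+2j j)) ⟩
    ∏[ j < suc n ] f (2 ℕ.* j) * ∏[ j < suc n ] f (suc (2 ℕ.* j))
      ∎
    where
    E = ∏[ j < n ] f (2 ℕ.+ 2 ℕ.* j)
    O = ∏[ j < n ] f (3 ℕ.+ 2 ℕ.* j)
    2+2j : ∀ j → 2 ℕ.+ 2 ℕ.* j ≡ 2 ℕ.* suc j
    2+2j j = sym (ℕₚ.*-suc 2 j)
    shuffle : ∀ a b e o → a * (b * (e * o)) ≡ a * e * (b * o)
    shuffle = solve-∀

  factorial : ℕ → ℤ
  factorial n = ∏[ i < n ] (+ suc i)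

  oddProduct : ℕ → ℤ
  oddProduct m = ∏[ j < m ] (+ suc (2 ℕ.* j))

  factorial-+ : ∀ k m → factorial (k ℕ.+ m) ≡ factorial k * ∏[ i < m ] (+ (suc k ℕ.+ i))
  factorial-+ k m = ∏-+ k m (λ i → + suc i)

  factorial-double : ∀ k → factorial (k ℕ.+ k) ≡ 2ℤ ^ k * factorial k * oddProduct k
  factorial-double k = begin
    factorial (k ℕ.+ k)                                ≡⟨ ∏-evens-odds k (λ i → + suc i) ⟩
    oddProduct k * ∏[ j < k ] (+ suc (suc (2 ℕ.* j)))  ≡⟨ cong (oddProduct k *_) evens ⟩
    oddProduct k * (2ℤ ^ k * factorial k)              ≡⟨ *-comm (oddProduct k) _ ⟩
    2ℤ ^ k * factorial k * oddProduct k                ∎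
    where
    2+2j≡2[1+j] : ∀ j → + suc (suc (2 ℕ.* j)) ≡ 2ℤ * + suc j
    2+2j≡2[1+j] j = trans (cong +_ (sym (ℕₚ.*-suc 2 j))) (pos-* 2 (suc j))
    evens : ∏[ j < k ] (+ suc (suc (2 ℕ.* j))) ≡ 2ℤ ^ k * factorial k
    evens = begin
      ∏[ j < k ] (+ suc (suc (2 ℕ.* j)))  ≡⟨ ∏-cong k (λ {j} _ → 2+2j≡2[1+j] j) ⟩
      ∏[ j < k ] (2ℤ * + suc j)           ≡⟨ ∏-distrib-* k (λ _ → 2ℤ) (λ j → + suc j) ⟩
      ∏[ j < k ] 2ℤ * factorial k         ≡⟨ cong (_* factorial k) (∏-const k 2ℤ) ⟩
      2ℤ ^ k * factorial k                ∎

  factorial-halves : ∀ {k m} → Halves k m → factorial (k ℕ.+ m) ≡ 2ℤ ^ k * factorial k * oddProduct m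
  factorial-halves {k} (inj₁ refl) = factorial-double k
  factorial-halves {k} (inj₂ refl) = begin
    factorial (k ℕ.+ suc k)
      ≡⟨ cong factorial (ℕₚ.+-suc k k) ⟩
    factorial (suc (k ℕ.+ k))
      ≡⟨ ∏-suc (k ℕ.+ k) (λ i → + suc i) ⟩
    factorial (k ℕ.+ k) * + suc (k ℕ.+ k)
      ≡⟨ cong₂ _*_ (factorial-double k) (cong (λ n → + suc (k ℕ.+ n)) (sym (ℕₚ.+-identityʳ k))) ⟩
    2ℤ ^ k * factorial k * oddProduct k * + suc (2 ℕ.* k)
      ≡⟨ *-assoc (2ℤ ^ k * factorial k) _ _ ⟩
    2ℤ ^ k * factorial k * (oddProduct k * + suc (2 ℕ.* k))
      ≡⟨ cong (2ℤ ^ k * factorial k *_) (sym (∏-suc k (λ j → + suc (2 ℕ.* j)))) ⟩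
    2ℤ ^ k * factorial k * oddProduct (suc k)
      ∎

  ^-distribʳ-* : ∀ a b n → (a * b) ^ n ≡ a ^ n * b ^ n
  ^-distribʳ-* a b zero    = refl
  ^-distribʳ-* a b (suc n) = trans (cong (a * b *_) (^-distribʳ-* a b n)) (interchange a b _ _)

  ^-comm : ∀ a m n → (a ^ m) ^ n ≡ (a ^ n) ^ m
  ^-comm a m n = trans (^-*-assoc a m n) (trans (cong (a ^_) (ℕₚ.*-comm m n)) (sym (^-*-assoc a n m)))

  neg1^-+ : ∀ m n → neg1^ (m ℕ.+ n) ≡ neg1^ m * neg1^ n
  neg1^-+ zero    n = sym (*-identityˡ (neg1^ n))
  neg1^-+ (suc m) n = trans (cong -_ (neg1^-+ m n)) (neg-distribˡ-* (neg1^ m) (neg1^ n))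

  neg1^-double : ∀ n → neg1^ (n ℕ.+ n) ≡ 1ℤ
  neg1^-double zero    = refl
  neg1^-double (suc n) =
    trans (cong (-_ ∘ neg1^) (ℕₚ.+-suc n n)) (trans (neg-involutive _) (neg1^-double n))

  neg1^-square : ∀ n → neg1^ n * neg1^ n ≡ 1ℤ
  neg1^-square n = trans (sym (neg1^-+ n n)) (neg1^-double n)

  neg1^-parity : ∀ {e} t r → e ≡ (t ℕ.+ t) ℕ.+ r → neg1^ e ≡ neg1^ r
  neg1^-parity t r refl = begin
    neg1^ (t ℕ.+ t ℕ.+ r)       ≡⟨ neg1^-+ (t ℕ.+ t) r ⟩
    neg1^ (t ℕ.+ t) * neg1^ r   ≡⟨ cong (_* neg1^ r) (neg1^-double t) ⟩
    1ℤ * neg1^ r                ≡⟨ *-identityˡ (neg1^ r) ⟩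
    neg1^ r                     ∎

  neg1^-^ : ∀ m n → neg1^ m ^ n ≡ neg1^ (m ℕ.* n)
  neg1^-^ m zero    = cong neg1^ (sym (ℕₚ.*-zeroʳ m))
  neg1^-^ m (suc n) = begin
    neg1^ m * neg1^ m ^ n       ≡⟨ cong (neg1^ m *_) (neg1^-^ m n) ⟩
    neg1^ m * neg1^ (m ℕ.* n)   ≡⟨ sym (neg1^-+ m (m ℕ.* n)) ⟩
    neg1^ (m ℕ.+ m ℕ.* n)       ≡⟨ cong neg1^ (sym (ℕₚ.*-suc m n)) ⟩
    neg1^ (m ℕ.* suc n)         ∎

  neg1^≡1∨-1 : ∀ n → neg1^ n ≡ 1ℤ ⊎ neg1^ n ≡ -1ℤ
  neg1^≡1∨-1 zero    = inj₁ refl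
  neg1^≡1∨-1 (suc n) = Sum.swap (Sum.map (cong -_) (cong -_) (neg1^≡1∨-1 n))

  -2^ : ∀ m → (- 2ℤ) ^ m ≡ neg1^ m * 2ℤ ^ m
  -2^ zero    = refl
  -2^ (suc m) = trans (cong (- 2ℤ *_) (-2^ m)) (shuffle (neg1^ m) (2ℤ ^ m))
    where
    shuffle : ∀ s t → - 2ℤ * (s * t) ≡ - s * (2ℤ * t)
    shuffle = solve-∀

  2^k*-2^m : ∀ k m → 2ℤ ^ k * (- 2ℤ) ^ m ≡ neg1^ m * 2ℤ ^ (k ℕ.+ m)
  2^k*-2^m k m = begin
    2ℤ ^ k * (- 2ℤ) ^ m          ≡⟨ cong (2ℤ ^ k *_) (-2^ m) ⟩
    2ℤ ^ k * (neg1^ m * 2ℤ ^ m)  ≡⟨ x∙yz≈y∙xz (2ℤ ^ k) (neg1^ m) (2ℤ ^ m) ⟩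
    neg1^ m * (2ℤ ^ k * 2ℤ ^ m)  ≡⟨ cong (neg1^ m *_) (sym (^-distribˡ-+-* 2ℤ k m)) ⟩
    neg1^ m * 2ℤ ^ (k ℕ.+ m)     ∎

  [2^k*-2^m]^n : ∀ k m n → (2ℤ ^ k * (- 2ℤ) ^ m) ^ n ≡ neg1^ (m ℕ.* n) * (2ℤ ^ n) ^ (k ℕ.+ m)
  [2^k*-2^m]^n k m n = begin
    (2ℤ ^ k * (- 2ℤ) ^ m) ^ n               ≡⟨ cong (_^ n) (2^k*-2^m k m) ⟩
    (neg1^ m * 2ℤ ^ (k ℕ.+ m)) ^ n          ≡⟨ ^-distribʳ-* (neg1^ m) _ n ⟩
    neg1^ m ^ n * (2ℤ ^ (k ℕ.+ m)) ^ n      ≡⟨ cong₂ _*_ (neg1^-^ m n) (^-comm 2ℤ (k ℕ.+ m) n) ⟩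
    neg1^ (m ℕ.* n) * (2ℤ ^ n) ^ (k ℕ.+ m)  ∎

module ModPrime {p : ℕ} (p-prime : Prime p) where

  open import Data.Integer using (ℤ; +_; -_; _+_; _-_; _*_; _^_; 0ℤ; 1ℤ; ∣_∣; _%ℕ_; _/ℕ_)
  open import Data.Integer.Properties
    using (*-comm; *-assoc; *-identityʳ; *-zeroʳ; +-identityʳ; +-inverseʳ; *-commutativeSemigroup;
           abs-*; pos-+; pos-*; neg-involutive; neg-distribˡ-*; m-n≡m⊖n; ∣⊖∣-≤)
  open import Algebra.Properties.CommutativeSemigroup *-commutativeSemigroup using (x∙yz≈y∙xz)
  open import Data.Integer.Divisibility.Signed
    using (_∣_; divides; ∣-refl; ∣m∣n⇒∣m+n; ∣m⇒∣-m; ∣n⇒∣m*n; ∣⇒∣ᵤ; ∣ᵤ⇒∣)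
  open import Data.Integer.DivMod using (a≡a%ℕn+[a/ℕn]*n; n%ℕd<d)
  open import Data.Integer.Tactic.RingSolver using (solve-∀)
  open import Data.Nat.DivMod using (_%_; m%n<n)
  open import Data.Nat.Coprimality using (prime⇒coprime; coprime-Bézout)
  open import Data.Nat.Divisibility using () renaming (_∣_ to infix 4 _∣ℕ_; ∣⇒≤ to ∣ℕ⇒≤)
  import Data.Nat.GCD as GCD
  open import Relation.Binary.Bundles using (Setoid)
  import Relation.Binary.Reasoning.Setoid
  open IntegerIdentities

  instance
    p-nonZero : ℕ.NonZero p
    p-nonZero = prime⇒nonZero p-prime

  1<p : 1 < p
  1<p = ℕ.nonTrivial⇒n>1 p {{prime⇒nonTrivial p-prime}}

  infix 4 _≈_ _≉_
  record _≈_ (x y : ℤ) : Set where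
    constructor mod-p
    field p∣x-y : + p ∣ x - y

  _≉_ : ℤ → ℤ → Set
  x ≉ y = ¬ x ≈ y

  ≈-by : ∀ {x y d} → + p ∣ d → d ≡ x - y → x ≈ y
  ≈-by p∣d refl = mod-p p∣d

  ≈-refl : ∀ {x} → x ≈ x
  ≈-refl {x} = mod-p (divides 0ℤ (+-inverseʳ x))

  ≈-reflexive : ∀ {x y} → x ≡ y → x ≈ y
  ≈-reflexive refl = ≈-refl

  ≈-sym : ∀ {x y} → x ≈ y → y ≈ x
  ≈-sym {x} {y} (mod-p p∣x-y) = ≈-by (∣m⇒∣-m p∣x-y) (lemma x y)
    where lemma : ∀ x y → - (x - y) ≡ y - x
          lemma = solve-∀

  ≈-trans : ∀ {x y z} → x ≈ y → y ≈ z → x ≈ z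
  ≈-trans {x} {y} {z} (mod-p p∣x-y) (mod-p p∣y-z) =
    ≈-by (∣m∣n⇒∣m+n p∣x-y p∣y-z) (lemma x y z)
    where lemma : ∀ x y z → (x - y) + (y - z) ≡ x - z
          lemma = solve-∀

  ≈-setoid : Setoid _ _
  ≈-setoid = record { Carrier = ℤ ; _≈_ = _≈_
                    ; isEquivalence = record { refl = ≈-refl ; sym = ≈-sym ; trans = ≈-trans } }

  module ≈-Reasoning = Relation.Binary.Reasoning.Setoid ≈-setoid

  *-cong : ∀ {a b c d} → a ≈ b → c ≈ d → a * c ≈ b * d
  *-cong {a} {b} {c} {d} (mod-p p∣a-b) (mod-p p∣c-d) =
    ≈-by (∣m∣n⇒∣m+n (∣n⇒∣m*n c p∣a-b) (∣n⇒∣m*n b p∣c-d)) (lemma a b c d)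
    where lemma : ∀ a b c d → c * (a - b) + b * (c - d) ≡ a * c - b * d
          lemma = solve-∀

  -‿cong : ∀ {a b} → a ≈ b → - a ≈ - b
  -‿cong {a} {b} (mod-p p∣a-b) = ≈-by (∣m⇒∣-m p∣a-b) (lemma a b)
    where lemma : ∀ a b → - (a - b) ≡ - a - - b
          lemma = solve-∀

  ^-congˡ : ∀ {a b} n → a ≈ b → a ^ n ≈ b ^ n
  ^-congˡ zero    a≈b = ≈-refl
  ^-congˡ (suc n) a≈b = *-cong a≈b (^-congˡ n a≈b)

  ∏-cong≈ : ∀ n {f g : ℕ → ℤ} → (∀ {i} → i < n → f i ≈ g i) → ∏ n f ≈ ∏ n g
  ∏-cong≈ zero    f≈g = ≈-refl
  ∏-cong≈ (suc n) f≈g = *-cong (f≈g z<s) (∏-cong≈ n (f≈g ∘ s<s))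

  ≈0⇒∣ : ∀ {x} → x ≈ 0ℤ → + p ∣ x
  ≈0⇒∣ {x} (mod-p p∣x-0) = subst (+ p ∣_) (+-identityʳ x) p∣x-0

  ∣ᵤ⇒≈0 : ∀ {x} → p ∣ℕ ∣ x ∣ → x ≈ 0ℤ
  ∣ᵤ⇒≈0 {x} p∣x = ≈-by (∣ᵤ⇒∣ p∣x) (sym (+-identityʳ x))

  ≈0⇒≈ : ∀ {x y} → x - y ≈ 0ℤ → x ≈ y
  ≈0⇒≈ = mod-p ∘ ≈0⇒∣

  ≈⇒-≈0 : ∀ {x y} → x ≈ y → x - y ≈ 0ℤ
  ≈⇒-≈0 {x} {y} (mod-p p∣x-y) = ≈-by p∣x-y (sym (+-identityʳ (x - y)))

  x*y≈0⇒x≈0∨y≈0 : ∀ x y → x * y ≈ 0ℤ → x ≈ 0ℤ ⊎ y ≈ 0ℤ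
  x*y≈0⇒x≈0∨y≈0 x y xy≈0 = Sum.map ∣ᵤ⇒≈0 ∣ᵤ⇒≈0
    (euclidsLemma ∣ x ∣ ∣ y ∣ p-prime (subst (p ∣ℕ_) (abs-* x y) (∣⇒∣ᵤ (≈0⇒∣ xy≈0))))

  *-cancelˡ-≈ : ∀ {x y z} → x ≉ 0ℤ → x * y ≈ x * z → y ≈ z
  *-cancelˡ-≈ {x} {y} {z} x≉0 (mod-p p∣xy-xz) =
    [ ⊥-elim ∘ x≉0 , ≈0⇒≈ ]′ (x*y≈0⇒x≈0∨y≈0 x (y - z) (≈-by p∣xy-xz (lemma x y z)))
    where lemma : ∀ x y z → x * y - x * z ≡ x * (y - z) - 0ℤ
          lemma = solve-∀

  Unit : ℕ → Set
  Unit x = 0 < x × x < p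

  ∣∧<⇒≡0 : ∀ {d} → p ∣ℕ d → d < p → d ≡ 0
  ∣∧<⇒≡0 {zero}  _   _   = refl
  ∣∧<⇒≡0 {suc d} p∣d d<p = ⊥-elim (ℕₚ.<⇒≱ d<p (∣ℕ⇒≤ p∣d))

  Unit⇒∤ : ∀ {x} → Unit x → ¬ p ∣ℕ x
  Unit⇒∤ (0<x , x<p) p∣x = ℕₚ.<⇒≢ 0<x (sym (∣∧<⇒≡0 p∣x x<p))

  Unit⇒≉0 : ∀ {x} → Unit x → + x ≉ 0ℤ
  Unit⇒≉0 x-unit x≈0 = Unit⇒∤ x-unit (∣⇒∣ᵤ (≈0⇒∣ x≈0))

  ∏-≉0 : ∀ n {f : ℕ → ℤ} → (∀ {i} → i < n → f i ≉ 0ℤ) → ∏ n f ≉ 0ℤ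
  ∏-≉0 zero    f≉0     = Unit⇒≉0 (z<s , 1<p)
  ∏-≉0 (suc n) f≉0 f0*∏≈0 = [ f≉0 z<s , ∏-≉0 n (f≉0 ∘ s<s) ]′ (x*y≈0⇒x≈0∨y≈0 _ _ f0*∏≈0)

  ≤∧≈⇒≡ : ∀ {m n} → m ≤ n → n < p → + m ≈ + n → m ≡ n
  ≤∧≈⇒≡ {m} {n} m≤n n<p (mod-p p∣m-n) =
    ℕₚ.≤-antisym m≤n (ℕₚ.m∸n≡0⇒m≤n (∣∧<⇒≡0 p∣n∸m n∸m<p))
    where
    p∣n∸m : p ∣ℕ n ∸ m
    p∣n∸m = subst (p ∣ℕ_) (trans (cong ∣_∣ (m-n≡m⊖n m n)) (∣⊖∣-≤ m≤n)) (∣⇒∣ᵤ p∣m-n)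
    n∸m<p : n ∸ m < p
    n∸m<p = ℕₚ.≤-<-trans (ℕₚ.m∸n≤m n m) n<p

  ≈⇒≡ : ∀ {m n} → m < p → n < p → + m ≈ + n → m ≡ n
  ≈⇒≡ {m} {n} m<p n<p m≈n = [ (λ m≤n → ≤∧≈⇒≡ m≤n n<p m≈n)
                            , (λ n≤m → sym (≤∧≈⇒≡ n≤m m<p (≈-sym m≈n))) ]′ (ℕₚ.≤-total m n)

  ≈-%ℕ : ∀ z → z ≈ + (z %ℕ p)
  ≈-%ℕ z = mod-p (divides (z /ℕ p) (begin
    z - + r                ≡⟨ cong (_- + r) (a≡a%ℕn+[a/ℕn]*n z p) ⟩
    + r + z /ℕ p * + p - + r ≡⟨ lemma (+ r) (z /ℕ p * + p) ⟩
    z /ℕ p * + p           ∎))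
    where open ≡-Reasoning
          r = z %ℕ p
          lemma : ∀ a b → a + b - a ≡ b
          lemma = solve-∀

  ≈⇒%≡ : ∀ {m n} → + m ≈ + n → m % p ≡ n % p
  ≈⇒%≡ {m} {n} m≈n =
    ≈⇒≡ (m%n<n m p) (m%n<n n p) (≈-trans (≈-sym (≈-%ℕ (+ m))) (≈-trans m≈n (≈-%ℕ (+ n))))

  %≡⇒≈ : ∀ {m n} → m % p ≡ n % p → + m ≈ + n
  %≡⇒≈ {m} {n} eq =
    ≈-trans (≈-%ℕ (+ m)) (≈-trans (≈-reflexive (cong +_ eq)) (≈-sym (≈-%ℕ (+ n))))

  +≡p⇒≈- : ∀ {a b} → a ℕ.+ b ≡ p → + a ≈ - + b
  +≡p⇒≈- {a} {b} a+b≡p = mod-p (subst (+ p ∣_) p≡a--b ∣-refl)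
    where
    p≡a--b : + p ≡ + a - - + b
    p≡a--b = trans (cong +_ (sym a+b≡p))
                   (trans (pos-+ a b) (cong (_+_ (+ a)) (sym (neg-involutive (+ b)))))

  square⇒QR : ∀ x {a} → + x * + x ≈ + a → QR p a
  square⇒QR x x²≈a = x , ≈⇒%≡ (≈-trans (≈-reflexive (pos-* x x)) x²≈a)

  QR⇒root : ∀ {a} → Unit a → QR p a → ∃[ r ] Unit r × + r * + r ≈ + a
  QR⇒root {a} a-unit (x , x²≡a) = r , (0<r , m%n<n x p) , r²≈a
    where
    r = x % p
    r²≈a : + r * + r ≈ + a
    r²≈a = ≈-trans (*-cong (≈-sym (≈-%ℕ (+ x))) (≈-sym (≈-%ℕ (+ x))))
                   (≈-trans (≈-reflexive (sym (pos-* x x))) (%≡⇒≈ x²≡a))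
    0<r : 0 < r
    0<r = ℕₚ.n≢0⇒n>0 λ r≡0 → Unit⇒≉0 a-unit (≈-sym (subst (λ t → + t * + t ≈ + a) r≡0 r²≈a))

  inverse : ∀ {x} → Unit x → ∃[ w ] + x * w ≈ 1ℤ
  inverse {x@(suc _)} (_ , x<p) with coprime-Bézout (prime⇒coprime p-prime x<p)
  ... | GCD.Bézout.+- u v 1+vx≡up = - + v , mod-p (divides (- + u) (begin
    + x * - + v - 1ℤ       ≡⟨ lemma (+ x) (+ v) ⟩
    - (1ℤ + + v * + x)     ≡⟨ cong (λ t → - (1ℤ + t)) (sym (pos-* v x)) ⟩
    - + (1 ℕ.+ v ℕ.* x)    ≡⟨ cong (-_ ∘ +_) 1+vx≡up ⟩
    - + (u ℕ.* p)          ≡⟨ cong -_ (pos-* u p) ⟩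
    - (+ u * + p)          ≡⟨ neg-distribˡ-* (+ u) (+ p) ⟩
    - + u * + p            ∎))
    where open ≡-Reasoning
          lemma : ∀ x v → x * - v - 1ℤ ≡ - (1ℤ + v * x)
          lemma = solve-∀
  ... | GCD.Bézout.-+ u v 1+up≡vx = + v , mod-p (divides (+ u) (begin
    + x * + v - 1ℤ         ≡⟨ cong (_- 1ℤ) (trans (*-comm (+ x) (+ v)) (sym (pos-* v x))) ⟩
    + (v ℕ.* x) - 1ℤ       ≡⟨ cong (λ t → + t - 1ℤ) (sym 1+up≡vx) ⟩
    + (1 ℕ.+ u ℕ.* p) - 1ℤ ≡⟨ cong (λ t → 1ℤ + t - 1ℤ) (pos-* u p) ⟩
    1ℤ + + u * + p - 1ℤ    ≡⟨ lemma (+ u * + p) ⟩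
    + u * + p              ∎))
    where open ≡-Reasoning
          lemma : ∀ t → 1ℤ + t - 1ℤ ≡ t
          lemma = solve-∀

  partner : ∀ {a x} → Unit a → Unit x → ∃[ y ] Unit y × + x * + y ≈ + a
  partner {a} {x} a-unit x-unit = y , (0<y , n%ℕd<d (+ a * w) p) , xy≈a
    where
    open ≈-Reasoning
    w = proj₁ (inverse x-unit)
    y = (+ a * w) %ℕ p
    xy≈a : + x * + y ≈ + a
    xy≈a = begin
      + x * + y        ≈⟨ *-cong (≈-refl {+ x}) (≈-sym (≈-%ℕ (+ a * w))) ⟩
      + x * (+ a * w)  ≡⟨ x∙yz≈y∙xz (+ x) (+ a) w ⟩
      + a * (+ x * w)  ≈⟨ *-cong (≈-refl {+ a}) (proj₂ (inverse x-unit)) ⟩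
      + a * 1ℤ         ≡⟨ *-identityʳ (+ a) ⟩
      + a              ∎
    0<y : 0 < y
    0<y = ℕₚ.n≢0⇒n>0 λ y≡0 → Unit⇒≉0 a-unit
      (≈-trans (≈-sym xy≈a) (≈-reflexive (trans (cong (λ t → + x * + t) y≡0) (*-zeroʳ (+ x)))))

  partner-unique : ∀ {x y z c} → Unit x → y < p → z < p → + y * + x ≈ c → + z * + x ≈ c → y ≡ z
  partner-unique {x} {y} {z} x-unit y<p z<p yx≈c zx≈c =
    ≈⇒≡ y<p z<p (*-cancelˡ-≈ (Unit⇒≉0 x-unit) (begin
    + x * + y  ≡⟨ *-comm (+ x) (+ y) ⟩
    + y * + x  ≈⟨ yx≈c ⟩
    _          ≈⟨ ≈-sym zx≈c ⟩
    + z * + x  ≡⟨ *-comm (+ z) (+ x) ⟩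
    + x * + z  ∎))
    where open ≈-Reasoning

  Paired : ℤ → List ℕ → Set
  Paired c L = ∀ {x} → x ∈ L → ∃[ y ] y ∈ L × y ≢ x × + x * + y ≈ c

  Paired-without : ∀ {c x xs y} → (∀ {z} → z ∈ x ∷ xs → Unit z) → All (x ≢_) xs →
                   Paired c (x ∷ xs) → y ∈ xs → + x * + y ≈ c → Paired c (xs without y)
  Paired-without {c} {x} {xs} {y} L-units x∉xs paired y∈xs xy≈c z∈xs∖y
    with z∈xs , z≢y ← ∈-without⁻ z∈xs∖y
    with paired (there z∈xs)
  ... | _ , here refl , _ , zx≈c = ⊥-elim (z≢y (partner-unique (L-units (here refl)) z<p y<p zx≈c yx≈c))
    where
    z<p = proj₂ (L-units (there z∈xs))
    y<p = proj₂ (L-units (there y∈xs))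
    yx≈c = ≈-trans (≈-reflexive (*-comm (+ y) (+ x))) xy≈c
  ... | w , there w∈xs , w≢z , zw≈c = w , ∈-without⁺ w∈xs w≢y , w≢z , zw≈c
    where
    w≢y : w ≢ y
    w≢y refl = All.lookup x∉xs z∈xs
      (sym (partner-unique (L-units (there y∈xs)) (proj₂ (L-units (there z∈xs))) (proj₂ (L-units (here refl)))
                           zw≈c xy≈c))

  product-paired : ∀ m {c L} → length L ≡ m ℕ.+ m → Unique L → (∀ {x} → x ∈ L → Unit x) →
                   Paired c L → + product L ≈ c ^ m
  product-paired zero    {L = []}     _   _              _     _      = ≈-refl
  product-paired (suc m) {c} {x ∷ xs} len (x∉xs ∷ uniq) L-units paired with paired (here refl)
  ... | y , here y≡x , y≢x , _ = ⊥-elim (y≢x y≡x)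
  ... | y , there y∈xs , _ , xy≈c = begin
    + (x ℕ.* product xs)                    ≡⟨ pos-* x (product xs) ⟩
    + x * + product xs                      ≡⟨ cong (λ t → + x * + t) (product-↭ xs↭) ⟩
    + x * + (y ℕ.* product (xs without y))  ≡⟨ cong (+ x *_) (pos-* y _) ⟩
    + x * (+ y * + product (xs without y))  ≡⟨ sym (*-assoc (+ x) (+ y) _) ⟩
    + x * + y * + product (xs without y)    ≈⟨ *-cong xy≈c ∏≈c^m ⟩
    c * c ^ m                               ∎
    where
    open ≈-Reasoning
    xs↭ = ↭-without uniq y∈xs
    len′ : length (xs without y) ≡ m ℕ.+ m
    len′ = ℕₚ.suc-injective (trans (sym (↭-length xs↭)) (trans (ℕₚ.suc-injective len) (ℕₚ.+-suc m m)))
    L-units′ : ∀ {z} → z ∈ xs without y → Unit z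
    L-units′ = L-units ∘ there ∘ proj₁ ∘ ∈-without⁻
    paired′ : Paired c (xs without y)
    paired′ = Paired-without L-units x∉xs paired y∈xs xy≈c
    ∏≈c^m : + product (xs without y) ≈ c ^ m
    ∏≈c^m = product-paired m len′ (without-unique y uniq) L-units′ paired′

-- Euler's criterion, by Wilson's pairing argument: x ↦ a/x pairs off the units 1, …, p − 1 into
-- h pairs with product a, except that for a residue a the two roots ±r of a are fixed points.
module Euler {p h : ℕ} (p-prime : Prime p) (p≡1+2h : p ≡ suc (h ℕ.+ h)) where

  open import Data.Integer using (+_; -_; _+_; _-_; _*_; _^_; 0ℤ; 1ℤ; -1ℤ; _%ℕ_)
  open import Data.Integer.Properties
    using (*-identityˡ; ^-zeroˡ; pos-*; neg-involutive; neg-distribˡ-*; -1*i≡-i)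
  open import Data.Integer.Tactic.RingSolver using (solve-∀)
  open import Data.Nat.DivMod using (_%_; m%n<n)
  open import Relation.Nullary.Decidable using (toSum)
  open IntegerIdentities
  open ModPrime p-prime

  units : List ℕ
  units = applyUpTo suc (h ℕ.+ h)

  ∈-units⁺ : ∀ {x} → Unit x → x ∈ units
  ∈-units⁺ {suc i} (_ , x<p) = ∈-applyUpTo⁺ suc (ℕ.s<s⁻¹ (subst (suc i <_) p≡1+2h x<p))

  ∈-units⁻ : ∀ {x} → x ∈ units → Unit x
  ∈-units⁻ x∈ with i , i<2h , refl ← ∈-applyUpTo⁻ suc x∈ =
    z<s , subst (suc i <_) (sym p≡1+2h) (s<s i<2h)

  units-unique : Unique units
  units-unique = Unique.applyUpTo⁺₁ suc (h ℕ.+ h) (λ i<j _ → ℕₚ.<⇒≢ (s<s i<j))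

  product-units-NR : ∀ {a} → Unit a → ¬ QR p a → + product units ≈ (+ a) ^ h
  product-units-NR {a} a-unit ¬qr =
    product-paired h (length-applyUpTo suc (h ℕ.+ h)) units-unique ∈-units⁻ paired
    where
    paired : Paired (+ a) units
    paired {x} x∈ =
      let y , y-unit , xy≈a = partner a-unit (∈-units⁻ x∈)
          y≢x : y ≢ x
          y≢x y≡x = ¬qr (square⇒QR x (subst (λ t → + x * + t ≈ + a) y≡x xy≈a))
      in y , ∈-units⁺ y-unit , y≢x , xy≈a

  module Roots {a r} (a-unit : Unit a) (r-unit : Unit r) (r²≈a : + r * + r ≈ + a) where

    s : ℕ
    s = p ∸ r

    s≈-r : + s ≈ - + r
    s≈-r = +≡p⇒≈- (trans (ℕₚ.+-comm s r) (ℕₚ.m+[n∸m]≡n (ℕₚ.<⇒≤ (proj₂ r-unit))))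

    s-unit : Unit s
    s-unit = let 0<r , r<p = r-unit in ℕₚ.m<n⇒0<n∸m r<p , ℕₚ.∸-monoʳ-< 0<r (ℕₚ.<⇒≤ r<p)

    s≢r : s ≢ r
    s≢r s≡r = ℕₚ.even≢odd r h (begin
      2 ℕ.* r        ≡⟨ cong (r ℕ.+_) (ℕₚ.+-identityʳ r) ⟩
      r ℕ.+ r        ≡⟨ cong (r ℕ.+_) (sym s≡r) ⟩
      r ℕ.+ s        ≡⟨ ℕₚ.m+[n∸m]≡n (ℕₚ.<⇒≤ (proj₂ r-unit)) ⟩
      p              ≡⟨ trans p≡1+2h (cong (suc ∘ (h ℕ.+_)) (sym (ℕₚ.+-identityʳ h))) ⟩
      suc (2 ℕ.* h)  ∎)
      where open ≡-Reasoning

    s²≈a : + s * + s ≈ + a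
    s²≈a = ≈-trans (*-cong s≈-r s≈-r) (≈-trans (≈-reflexive (-x*-x≡x*x (+ r))) r²≈a)
      where -x*-x≡x*x : ∀ x → - x * - x ≡ x * x
            -x*-x≡x*x = solve-∀

    roots : ∀ {z} → z < p → + z * + z ≈ + a → z ≡ r ⊎ z ≡ s
    roots {z} z<p z²≈a =
      Sum.map (≈⇒≡ z<p (proj₂ r-unit) ∘ ≈0⇒≈) (≈⇒≡ z<p (proj₂ s-unit) ∘ z≈s)
              (x*y≈0⇒x≈0∨y≈0 (+ z - + r) (+ z + + r) [z-r][z+r]≈0)
      where
      difference-of-squares : ∀ z r → z * z - r * r ≡ (z - r) * (z + r)
      difference-of-squares = solve-∀
      [z-r][z+r]≈0 : (+ z - + r) * (+ z + + r) ≈ 0ℤ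
      [z-r][z+r]≈0 = subst (_≈ 0ℤ) (difference-of-squares (+ z) (+ r))
                           (≈⇒-≈0 (≈-trans z²≈a (≈-sym r²≈a)))
      z≈s : + z + + r ≈ 0ℤ → + z ≈ + s
      z≈s z+r≈0 = ≈-trans (≈0⇒≈ (subst (_≈ 0ℤ) (cong (_+_ (+ z)) (sym (neg-involutive (+ r)))) z+r≈0))
                          (≈-sym s≈-r)

    others : List ℕ
    others = units without r without s

    units↭ : units ↭ r ∷ s ∷ others
    units↭ = ↭-trans (↭-without units-unique (∈-units⁺ r-unit))
                     (↭-prep r (↭-without (without-unique r units-unique)
                                          (∈-without⁺ (∈-units⁺ s-unit) s≢r)))

    ∈-others⁻ : ∀ {x} → x ∈ others → Unit x × x ≢ r × x ≢ s
    ∈-others⁻ x∈ with x∈′ , x≢s ← ∈-without⁻ x∈ with x∈″ , x≢r ← ∈-without⁻ x∈′ =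
      ∈-units⁻ x∈″ , x≢r , x≢s

    others-paired : Paired (+ a) others
    others-paired {x} x∈ with x-unit , x≢r , x≢s ← ∈-others⁻ x∈ =
      let y , y-unit , xy≈a = partner a-unit x-unit
          x*t≈a : ∀ {t} → y ≡ t → + x * + t ≈ + a
          x*t≈a y≡t = subst (λ t → + x * + t ≈ + a) y≡t xy≈a
          y≢x : y ≢ x
          y≢x y≡x = [ x≢r , x≢s ]′ (roots (proj₂ x-unit) (x*t≈a y≡x))
          y≢r : y ≢ r
          y≢r y≡r = x≢r (partner-unique r-unit (proj₂ x-unit) (proj₂ r-unit) (x*t≈a y≡r) r²≈a)
          y≢s : y ≢ s
          y≢s y≡s = x≢s (partner-unique s-unit (proj₂ x-unit) (proj₂ s-unit) (x*t≈a y≡s) s²≈a)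
      in y , ∈-without⁺ (∈-without⁺ (∈-units⁺ y-unit) y≢r) y≢s , y≢x , xy≈a

    product-units : + product units ≈ - ((+ a) ^ h)
    product-units
      with m , h≡1+m , len ← halve-2+ h (trans (sym (length-applyUpTo suc _)) (↭-length units↭)) = begin
      + product units                       ≡⟨ cong +_ (product-↭ units↭) ⟩
      + (r ℕ.* (s ℕ.* product others))      ≡⟨ trans (pos-* r _) (cong (+ r *_) (pos-* s _)) ⟩
      + r * (+ s * + product others)        ≈⟨ *-cong (≈-refl {+ r}) (*-cong s≈-r product-others) ⟩
      + r * (- + r * (+ a) ^ m)             ≡⟨ rearrange (+ r) ((+ a) ^ m) ⟩
      - (+ r * + r) * (+ a) ^ m             ≈⟨ *-cong (-‿cong r²≈a) (≈-refl {(+ a) ^ m}) ⟩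
      - + a * (+ a) ^ m                     ≡⟨ sym (neg-distribˡ-* (+ a) _) ⟩
      - ((+ a) ^ suc m)                     ≡⟨ cong (λ n → - ((+ a) ^ n)) (sym h≡1+m) ⟩
      - ((+ a) ^ h)                         ∎
      where
      open ≈-Reasoning
      product-others : + product others ≈ (+ a) ^ m
      product-others = product-paired m len (without-unique s (without-unique r units-unique))
                                      (proj₁ ∘ ∈-others⁻) others-paired
      rearrange : ∀ x t → x * (- x * t) ≡ - (x * x) * t
      rearrange = solve-∀

  wilson : + product units ≈ -1ℤ
  wilson = ≈-trans (Roots.product-units 1-unit 1-unit ≈-refl) (≈-reflexive (cong -_ (^-zeroˡ h)))
    where 1-unit = z<s , 1<p

  euler-NR : ∀ {a} → Unit a → ¬ QR p a → (+ a) ^ h ≈ -1ℤ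
  euler-NR a-unit ¬qr = ≈-trans (≈-sym (product-units-NR a-unit ¬qr)) wilson

  euler-QR : ∀ {a} → Unit a → QR p a → (+ a) ^ h ≈ 1ℤ
  euler-QR {a} a-unit qr =
    let r , r-unit , r²≈a = QR⇒root a-unit qr in
    ≈-trans (≈-reflexive (sym (neg-involutive ((+ a) ^ h))))
            (-‿cong (≈-trans (≈-sym (Roots.product-units a-unit r-unit r²≈a)) wilson))

  square^h≈1 : ∀ {z} → z ≉ 0ℤ → (z * z) ^ h ≈ 1ℤ
  square^h≈1 {z} z≉0 = ≈-trans (^-congˡ h z²≈a) (euler-QR a-unit (square⇒QR r r²≈a))
    where
    r = z %ℕ p
    a = (r ℕ.* r) % p
    r²≈a : + r * + r ≈ + a
    r²≈a = ≈-trans (≈-reflexive (sym (pos-* r r))) (≈-%ℕ (+ (r ℕ.* r)))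
    z²≈a : z * z ≈ + a
    z²≈a = ≈-trans (*-cong (≈-%ℕ z) (≈-%ℕ z)) r²≈a
    a≢0 : a ≢ 0
    a≢0 a≡0 = [ z≉0 , z≉0 ]′ (x*y≈0⇒x≈0∨y≈0 z z (≈-trans z²≈a (≈-reflexive (cong +_ a≡0))))
    a-unit : Unit a
    a-unit = ℕₚ.n≢0⇒n>0 a≢0 , m%n<n (r ℕ.* r) p

  2<p : 2 < p
  2<p = subst (2 <_) (sym p≡1+2h) (odd>1⇒>2 h (subst (1 <_) p≡1+2h 1<p))
    where
    odd>1⇒>2 : ∀ n → 1 < suc (n ℕ.+ n) → 2 < suc (n ℕ.+ n)
    odd>1⇒>2 zero    (s≤s ())
    odd>1⇒>2 (suc n) _ = s<s (s<s (ℕₚ.≤-trans (s≤s z≤n) (ℕₚ.m≤n+m (suc n) n)))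

  1≉-1 : 1ℤ ≉ -1ℤ
  1≉-1 (mod-p p∣2) = Unit⇒≉0 (z<s , 2<p) (mod-p p∣2)

  neg1^-≈⇒≡ : ∀ m n → neg1^ m ≈ neg1^ n → neg1^ m ≡ neg1^ n
  neg1^-≈⇒≡ m n m≈n with neg1^≡1∨-1 m | neg1^≡1∨-1 n
  ... | inj₁ m≡1  | inj₁ n≡1  = trans m≡1 (sym n≡1)
  ... | inj₂ m≡-1 | inj₂ n≡-1 = trans m≡-1 (sym n≡-1)
  ... | inj₁ m≡1  | inj₂ n≡-1 = ⊥-elim (1≉-1 (subst₂ _≈_ m≡1 n≡-1 m≈n))
  ... | inj₂ m≡-1 | inj₁ n≡1  = ⊥-elim (1≉-1 (subst₂ _≈_ n≡1 m≡-1 (≈-sym m≈n)))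

  #NR : List ℕ → ℕ
  #NR xs = length (filter (nonResidue? p) xs)

  neg1^-#NR-∷ : ∀ {a} xs → Unit a → neg1^ (#NR (a ∷ xs)) ≈ (+ a) ^ h * neg1^ (#NR xs)
  neg1^-#NR-∷ {a} xs a-unit = [ non-residue , residue ]′ (toSum (nonResidue? p a))
    where
    open ≈-Reasoning
    non-residue : NonResidue p a → neg1^ (#NR (a ∷ xs)) ≈ (+ a) ^ h * neg1^ (#NR xs)
    non-residue nr@(_ , ¬qr) = begin
      neg1^ (#NR (a ∷ xs))        ≡⟨ cong (neg1^ ∘ length) (filter-accept (nonResidue? p) nr) ⟩
      - neg1^ (#NR xs)            ≡⟨ sym (-1*i≡-i (neg1^ (#NR xs))) ⟩
      -1ℤ * neg1^ (#NR xs)        ≈⟨ *-cong (≈-sym (euler-NR a-unit ¬qr)) (≈-refl {neg1^ (#NR xs)}) ⟩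
      (+ a) ^ h * neg1^ (#NR xs)  ∎
    residue : ¬ NonResidue p a → neg1^ (#NR (a ∷ xs)) ≈ (+ a) ^ h * neg1^ (#NR xs)
    residue ¬nr = begin
      neg1^ (#NR (a ∷ xs))        ≡⟨ cong (neg1^ ∘ length) (filter-reject (nonResidue? p) ¬nr) ⟩
      neg1^ (#NR xs)              ≡⟨ sym (*-identityˡ (neg1^ (#NR xs))) ⟩
      1ℤ * neg1^ (#NR xs)         ≈⟨ *-cong (≈-sym (euler-QR a-unit qr)) (≈-refl {neg1^ (#NR xs)}) ⟩
      (+ a) ^ h * neg1^ (#NR xs)  ∎
      where qr = [ id , (λ ¬qr → ⊥-elim (¬nr (Unit⇒∤ a-unit , ¬qr))) ]′ (toSum (qr? p a))

  neg1^-#NR : ∀ n (f : ℕ → ℕ) → (∀ {i} → i < n → Unit (f i)) →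
              neg1^ (#NR (applyUpTo f n)) ≈ (∏[ i < n ] (+ f i)) ^ h
  neg1^-#NR zero    f _     = ≈-reflexive (sym (^-zeroˡ h))
  neg1^-#NR (suc n) f f-units = begin
    neg1^ (#NR (f 0 ∷ applyUpTo (f ∘ suc) n))
      ≈⟨ neg1^-#NR-∷ (applyUpTo (f ∘ suc) n) (f-units z<s) ⟩
    (+ f 0) ^ h * neg1^ (#NR (applyUpTo (f ∘ suc) n))
      ≈⟨ *-cong (≈-refl {(+ f 0) ^ h}) (neg1^-#NR n (f ∘ suc) (f-units ∘ s<s)) ⟩
    (+ f 0) ^ h * (∏[ i < n ] (+ f (suc i))) ^ h
      ≡⟨ sym (^-distribʳ-* (+ f 0) _ h) ⟩
    (∏[ i < suc n ] (+ f i)) ^ h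
      ∎
    where open ≈-Reasoning

module BlockProducts {p h : ℕ} (p-prime : Prime p) (p≡1+2h : p ≡ suc (h ℕ.+ h)) where

  open import Data.Integer using (ℤ; +_; -_; _*_; _^_; 0ℤ; 1ℤ)
  open import Data.Integer.Properties
    using (*-comm; *-assoc; *-identityˡ; *-identityʳ; pos-*; neg-distribˡ-*)
  open import Data.Integer.Tactic.RingSolver using (solve-∀)
  open IntegerIdentities
  open ModPrime p-prime
  open Euler {h = h} p-prime p≡1+2h

  h<p : h < p
  h<p = subst (h <_) (sym p≡1+2h) (s≤s (ℕₚ.m≤m+n h h))

  fallingFactorial : ℕ → ℤ
  fallingFactorial m = ∏[ j < m ] (+ (h ∸ j))

  factorial-≉0 : ∀ {k} → k < p → factorial k ≉ 0ℤ
  factorial-≉0 {k} k<p = ∏-≉0 k λ i<k → Unit⇒≉0 (z<s , ℕₚ.≤-<-trans i<k k<p)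

  fallingFactorial-≉0 : ∀ {m} → m ≤ h → fallingFactorial m ≉ 0ℤ
  fallingFactorial-≉0 {m} m≤h = ∏-≉0 m λ {j} j<m →
    Unit⇒≉0 (ℕₚ.m<n⇒0<n∸m (ℕₚ.<-≤-trans j<m m≤h) , ℕₚ.≤-<-trans (ℕₚ.m∸n≤m h j) h<p)

  rising≡falling : ∀ x m → x ℕ.+ m ≡ h → ∏[ i < m ] (+ (suc x ℕ.+ i)) ≡ fallingFactorial m
  rising≡falling x m x+m≡h = trans (∏-reverse m _) (∏-cong m (λ i<m → cong +_ (entry i<m)))
    where
    open ≡-Reasoning
    entry : ∀ {i} → i < m → suc x ℕ.+ (m ∸ suc i) ≡ h ∸ i
    entry {i} i<m = begin
      suc x ℕ.+ (m ∸ suc i)  ≡⟨ sym (ℕₚ.+-suc x (m ∸ suc i)) ⟩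
      x ℕ.+ suc (m ∸ suc i)  ≡⟨ cong (x ℕ.+_) (sym (ℕₚ.+-∸-assoc 1 i<m)) ⟩
      x ℕ.+ (m ∸ i)          ≡⟨ sym (ℕₚ.+-∸-assoc x (ℕₚ.<⇒≤ i<m)) ⟩
      x ℕ.+ m ∸ i            ≡⟨ cong (_∸ i) x+m≡h ⟩
      h ∸ i                  ∎

  1+2j+2[h∸j]≡p : ∀ {j} → j ≤ h → suc (2 ℕ.* j) ℕ.+ 2 ℕ.* (h ∸ j) ≡ p
  1+2j+2[h∸j]≡p {j} j≤h = begin
    suc (2 ℕ.* j ℕ.+ 2 ℕ.* (h ∸ j))  ≡⟨ cong suc (sym (ℕₚ.*-distribˡ-+ 2 j (h ∸ j))) ⟩
    suc (2 ℕ.* (j ℕ.+ (h ∸ j)))      ≡⟨ cong (suc ∘ (2 ℕ.*_)) (ℕₚ.m+[n∸m]≡n j≤h) ⟩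
    suc (2 ℕ.* h)                    ≡⟨ cong (suc ∘ (h ℕ.+_)) (ℕₚ.+-identityʳ h) ⟩
    suc (h ℕ.+ h)                    ≡⟨ sym p≡1+2h ⟩
    p                                ∎
    where open ≡-Reasoning

  1+2j≈-2[h∸j] : ∀ {j} → j ≤ h → + suc (2 ℕ.* j) ≈ - 2ℤ * + (h ∸ j)
  1+2j≈-2[h∸j] {j} j≤h = ≈-trans (+≡p⇒≈- (1+2j+2[h∸j]≡p j≤h)) (≈-reflexive (begin
    - + (2 ℕ.* (h ∸ j))  ≡⟨ cong -_ (pos-* 2 (h ∸ j)) ⟩
    - (2ℤ * + (h ∸ j))   ≡⟨ neg-distribˡ-* 2ℤ (+ (h ∸ j)) ⟩
    - 2ℤ * + (h ∸ j)     ∎))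
    where open ≡-Reasoning

  oddProduct≈ : ∀ {m} → m ≤ h → oddProduct m ≈ (- 2ℤ) ^ m * fallingFactorial m
  oddProduct≈ {m} m≤h = begin
    oddProduct m
      ≈⟨ ∏-cong≈ m (λ j<m → 1+2j≈-2[h∸j] (ℕₚ.<⇒≤ (ℕₚ.<-≤-trans j<m m≤h))) ⟩
    ∏[ j < m ] (- 2ℤ * + (h ∸ j))
      ≡⟨ ∏-distrib-* m (λ _ → - 2ℤ) (λ j → + (h ∸ j)) ⟩
    ∏[ j < m ] (- 2ℤ) * fallingFactorial m
      ≡⟨ cong (_* fallingFactorial m) (∏-const m (- 2ℤ)) ⟩
    (- 2ℤ) ^ m * fallingFactorial m
      ∎
    where open ≈-Reasoning

  rising≈2^k*-2^m*falling : ∀ {k m} → Halves k m → k ℕ.+ m ≤ h →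
                ∏[ i < m ] (+ (suc k ℕ.+ i)) ≈ 2ℤ ^ k * (- 2ℤ) ^ m * fallingFactorial m
  rising≈2^k*-2^m*falling {k} {m} halves k+m≤h = *-cancelˡ-≈ (factorial-≉0 k<p) (begin
    factorial k * ∏[ i < m ] (+ (suc k ℕ.+ i))
      ≡⟨ sym (factorial-+ k m) ⟩
    factorial (k ℕ.+ m)
      ≡⟨ factorial-halves halves ⟩
    2ℤ ^ k * factorial k * oddProduct m
      ≈⟨ *-cong (≈-refl {2ℤ ^ k * factorial k}) (oddProduct≈ m≤h) ⟩
    2ℤ ^ k * factorial k * ((- 2ℤ) ^ m * fallingFactorial m)
      ≡⟨ rearrange (2ℤ ^ k) (factorial k) ((- 2ℤ) ^ m) (fallingFactorial m) ⟩
    factorial k * (2ℤ ^ k * (- 2ℤ) ^ m * fallingFactorial m)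
      ∎)
    where
    open ≈-Reasoning
    k<p : k < p
    k<p = ℕₚ.≤-<-trans (ℕₚ.m≤m+n k m) (ℕₚ.≤-<-trans k+m≤h h<p)
    m≤h : m ≤ h
    m≤h = ℕₚ.≤-trans (ℕₚ.m≤n+m m k) k+m≤h
    rearrange : ∀ a b c d → a * b * (c * d) ≡ b * (a * c * d)
    rearrange = solve-∀

  2^h≈neg1^ : ∀ {q c} → Halves q c → q ℕ.+ c ≡ h → 2ℤ ^ h ≈ neg1^ c
  2^h≈neg1^ {q} {c} halves q+c≡h = begin
    2ℤ ^ h                        ≡⟨ sym (*-identityˡ (2ℤ ^ h)) ⟩
    1ℤ * 2ℤ ^ h                   ≡⟨ cong (_* 2ℤ ^ h) (sym (neg1^-square c)) ⟩
    neg1^ c * neg1^ c * 2ℤ ^ h    ≡⟨ *-assoc (neg1^ c) (neg1^ c) (2ℤ ^ h) ⟩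
    neg1^ c * (neg1^ c * 2ℤ ^ h)  ≈⟨ *-cong (≈-refl {neg1^ c}) (≈-sym 1≈neg1^c*2^h) ⟩
    neg1^ c * 1ℤ                  ≡⟨ *-identityʳ (neg1^ c) ⟩
    neg1^ c                       ∎
    where
    open ≈-Reasoning
    D = fallingFactorial c
    D*1≈D*[2^q*-2^c] : D * 1ℤ ≈ D * (2ℤ ^ q * (- 2ℤ) ^ c)
    D*1≈D*[2^q*-2^c] = begin
      D * 1ℤ                        ≡⟨ *-identityʳ D ⟩
      D                             ≡⟨ sym (rising≡falling q c q+c≡h) ⟩
      ∏[ i < c ] (+ (suc q ℕ.+ i))  ≈⟨ rising≈2^k*-2^m*falling halves (ℕₚ.≤-reflexive q+c≡h) ⟩
      2ℤ ^ q * (- 2ℤ) ^ c * D       ≡⟨ *-comm _ D ⟩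
      D * (2ℤ ^ q * (- 2ℤ) ^ c)     ∎
    c≤h : c ≤ h
    c≤h = ℕₚ.≤-trans (ℕₚ.m≤n+m c q) (ℕₚ.≤-reflexive q+c≡h)
    1≈neg1^c*2^h : 1ℤ ≈ neg1^ c * 2ℤ ^ h
    1≈neg1^c*2^h = ≈-trans (*-cancelˡ-≈ (fallingFactorial-≉0 c≤h) D*1≈D*[2^q*-2^c])
                           (≈-reflexive (trans (2^k*-2^m q c) (cong (λ n → neg1^ c * 2ℤ ^ n) q+c≡h)))

  [rising*falling]^h : ∀ {q c k m} → Halves q c → q ℕ.+ c ≡ h → Halves k m → k ℕ.+ m ≤ h →
                       (∏[ i < m ] (+ (suc k ℕ.+ i)) * fallingFactorial m) ^ h
                         ≈ neg1^ (m ℕ.* h ℕ.+ c ℕ.* (k ℕ.+ m))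
  [rising*falling]^h {q} {c} {k} {m} q,c q+c≡h k,m k+m≤h = begin
    (∏[ i < m ] (+ (suc k ℕ.+ i)) * D) ^ h
      ≈⟨ ^-congˡ h (*-cong (rising≈2^k*-2^m*falling k,m k+m≤h) (≈-refl {D})) ⟩
    (Y * D * D) ^ h
      ≡⟨ cong (_^ h) (*-assoc Y D D) ⟩
    (Y * (D * D)) ^ h
      ≡⟨ ^-distribʳ-* Y (D * D) h ⟩
    Y ^ h * (D * D) ^ h
      ≈⟨ *-cong (≈-refl {Y ^ h}) (square^h≈1 (fallingFactorial-≉0 m≤h)) ⟩
    Y ^ h * 1ℤ
      ≡⟨ *-identityʳ (Y ^ h) ⟩
    Y ^ h
      ≡⟨ [2^k*-2^m]^n k m h ⟩
    neg1^ (m ℕ.* h) * (2ℤ ^ h) ^ (k ℕ.+ m)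
      ≈⟨ *-cong (≈-refl {neg1^ (m ℕ.* h)}) (^-congˡ (k ℕ.+ m) (2^h≈neg1^ q,c q+c≡h)) ⟩
    neg1^ (m ℕ.* h) * neg1^ c ^ (k ℕ.+ m)
      ≡⟨ cong (neg1^ (m ℕ.* h) *_) (neg1^-^ c (k ℕ.+ m)) ⟩
    neg1^ (m ℕ.* h) * neg1^ (c ℕ.* (k ℕ.+ m))
      ≡⟨ sym (neg1^-+ (m ℕ.* h) (c ℕ.* (k ℕ.+ m))) ⟩
    neg1^ (m ℕ.* h ℕ.+ c ℕ.* (k ℕ.+ m))
      ∎
    where
    open ≈-Reasoning
    D = fallingFactorial m
    Y = 2ℤ ^ k * (- 2ℤ) ^ m
    m≤h : m ≤ h
    m≤h = ℕₚ.≤-trans (ℕₚ.m≤n+m m k) k+m≤h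

  neg1^-#NR-blocks : ∀ {q c k m l} → Halves q c → q ℕ.+ c ≡ h →
                     Halves k m → h ≡ k ℕ.+ m ℕ.+ l ℕ.+ m →
                     neg1^ (#NR (applyUpTo (suc k ℕ.+_) m ++ applyUpTo (suc (k ℕ.+ m ℕ.+ l) ℕ.+_) m))
                       ≡ neg1^ (m ℕ.* h ℕ.+ c ℕ.* (k ℕ.+ m))
  neg1^-#NR-blocks {q} {c} {k} {m} {l} q,c q+c≡h k,m h≡k+m+l+m =
    neg1^-≈⇒≡ (#NR (B ++ D)) (m ℕ.* h ℕ.+ c ℕ.* (k ℕ.+ m)) (begin
    neg1^ (#NR (B ++ D))
      ≡⟨ cong (neg1^ ∘ length) (filter-++ (nonResidue? p) B D) ⟩
    neg1^ (length (filter (nonResidue? p) B ++ filter (nonResidue? p) D))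
      ≡⟨ cong neg1^ (length-++ (filter (nonResidue? p) B)) ⟩
    neg1^ (#NR B ℕ.+ #NR D)
      ≡⟨ neg1^-+ (#NR B) (#NR D) ⟩
    neg1^ (#NR B) * neg1^ (#NR D)
      ≈⟨ *-cong (neg1^-#NR m _ B-units) (neg1^-#NR m _ D-units) ⟩
    (∏[ i < m ] (+ (suc k ℕ.+ i))) ^ h * (∏[ i < m ] (+ (suc (k ℕ.+ m ℕ.+ l) ℕ.+ i))) ^ h
      ≡⟨ sym (^-distribʳ-* _ _ h) ⟩
    (∏[ i < m ] (+ (suc k ℕ.+ i)) * ∏[ i < m ] (+ (suc (k ℕ.+ m ℕ.+ l) ℕ.+ i))) ^ h
      ≡⟨ cong (λ t → (∏[ i < m ] (+ (suc k ℕ.+ i)) * t) ^ h)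
              (rising≡falling (k ℕ.+ m ℕ.+ l) m (sym h≡k+m+l+m)) ⟩
    (∏[ i < m ] (+ (suc k ℕ.+ i)) * fallingFactorial m) ^ h
      ≈⟨ [rising*falling]^h q,c q+c≡h k,m k+m≤h ⟩
    neg1^ (m ℕ.* h ℕ.+ c ℕ.* (k ℕ.+ m))
      ∎)
    where
    open ≈-Reasoning
    B = applyUpTo (suc k ℕ.+_) m
    D = applyUpTo (suc (k ℕ.+ m ℕ.+ l) ℕ.+_) m
    k+m≤h : k ℕ.+ m ≤ h
    k+m≤h = subst (k ℕ.+ m ≤_) (sym h≡k+m+l+m) (ℕₚ.≤-trans (ℕₚ.m≤m+n (k ℕ.+ m) l) (ℕₚ.m≤m+n _ m))
    B-units : ∀ {i} → i < m → Unit (suc k ℕ.+ i)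
    B-units i<m = z<s , ℕₚ.≤-<-trans (ℕₚ.≤-trans (ℕₚ.+-monoʳ-< k i<m) k+m≤h) h<p
    D-units : ∀ {i} → i < m → Unit (suc (k ℕ.+ m ℕ.+ l) ℕ.+ i)
    D-units i<m = z<s , ℕₚ.≤-<-trans (subst (_ ≤_) (sym h≡k+m+l+m) (ℕₚ.+-monoʳ-< (k ℕ.+ m ℕ.+ l) i<m)) h<p

open import Data.Nat using (_+_; _*_)
open import Data.Nat.Tactic.RingSolver using (solve)
open import Data.Integer using (+_; -_)
open IntegerIdentities using (neg1^-parity)

applyUpTo-++ : ∀ {A : Set} (f : ℕ → A) m n →
               applyUpTo f (m + n) ≡ applyUpTo f m ++ applyUpTo (λ i → f (m + i)) n
applyUpTo-++ f zero    n = refl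
applyUpTo-++ f (suc m) n = cong (f 0 ∷_) (applyUpTo-++ (f ∘ suc) m n)

filter-blocks : ∀ {P : Pred ℕ 0ℓ} (P? : Decidable P) {A B C D E : List ℕ} →
                All (¬_ ∘ P) A → All P B → All (¬_ ∘ P) C → All P D → All (¬_ ∘ P) E →
                filter P? ((((A ++ B) ++ C) ++ D) ++ E) ≡ B ++ D
filter-blocks P? {A} {B} {C} {D} {E} ¬A B✓ ¬C D✓ ¬E = begin
  filter P? ((((A ++ B) ++ C) ++ D) ++ E)
    ≡⟨ filter-++ P? (((A ++ B) ++ C) ++ D) E ⟩
  filter P? (((A ++ B) ++ C) ++ D) ++ filter P? E
    ≡⟨ cong₂ _++_ (filter-++ P? ((A ++ B) ++ C) D) (filter-none P? ¬E) ⟩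
  (filter P? ((A ++ B) ++ C) ++ filter P? D) ++ []
    ≡⟨ ++-identityʳ _ ⟩
  filter P? ((A ++ B) ++ C) ++ filter P? D
    ≡⟨ cong₂ _++_ (filter-++ P? (A ++ B) C) (filter-all P? D✓) ⟩
  (filter P? (A ++ B) ++ filter P? C) ++ D
    ≡⟨ cong (λ t → (t ++ filter P? C) ++ D) (filter-++ P? A B) ⟩
  ((filter P? A ++ filter P? B) ++ filter P? C) ++ D
    ≡⟨ cong₂ (λ a c → (a ++ c) ++ D) (cong₂ _++_ (filter-none P? ¬A) (filter-all P? B✓))
                                     (filter-none P? ¬C) ⟩
  (B ++ []) ++ D
    ≡⟨ cong (_++ D) (++-identityʳ B) ⟩
  B ++ D
    ∎
  where open ≡-Reasoning

≤-slack : ∀ {a b} d → a + d ≡ b → a ≤ b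
≤-slack {a} d refl = ℕₚ.m≤m+n a d

1+2n<2[1+n] : ∀ n → suc (n + n) < 2 * suc n
1+2n<2[1+n] n = ≤-slack 0 (solve (n ∷ []))

-- The integers of (p/8, p/4) are k+1, …, k+m and those of (3p/8, p/2) are k+m+l+1, …, h.
record Layout (p : ℕ) : Set where
  field
    h k m l       : ℕ
    p≡1+2h        : p ≡ suc (h + h)
    h≡k+m+l+m     : h ≡ k + m + l + m
    halves        : Halves k m
    8k≤p          : 8 * k ≤ p
    p<8[1+k]      : p < 8 * suc k
    4[k+m]<p      : 4 * (k + m) < p
    p≤4[1+k+m]    : p ≤ 4 * suc (k + m)
    8[k+m+l]≤3p   : 8 * (k + m + l) ≤ 3 * p
    3p<8[1+k+m+l] : 3 * p < 8 * suc (k + m + l)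

module _ {p : ℕ} (L : Layout p) where

  open Layout L

  below-first-block : ∀ {a} → a ≤ k → ¬ InRange p a
  below-first-block a≤k (inj₁ (p<8a , _))  = ℕₚ.<⇒≱ p<8a (ℕₚ.≤-trans (ℕₚ.*-monoʳ-≤ 8 a≤k) 8k≤p)
  below-first-block a≤k (inj₂ (3p<8a , _)) =
    ℕₚ.<⇒≱ 3p<8a (ℕₚ.≤-trans (ℕₚ.≤-trans (ℕₚ.*-monoʳ-≤ 8 a≤k) 8k≤p) (ℕₚ.m≤m+n p (2 * p)))

  first-block : ∀ {i} → i < m → InRange p (suc k + i)
  first-block {i} i<m =
    inj₁ ( ℕₚ.<-≤-trans p<8[1+k] (ℕₚ.*-monoʳ-≤ 8 (ℕₚ.m≤m+n (suc k) i))
         , ℕₚ.≤-<-trans (ℕₚ.*-monoʳ-≤ 4 (ℕₚ.+-monoʳ-< k i<m)) 4[k+m]<p )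

  between-blocks : ∀ {i} → i < l → ¬ InRange p (suc k + m + i)
  between-blocks {i} i<l (inj₁ (_ , 4a<p)) =
    ℕₚ.<⇒≱ 4a<p (ℕₚ.≤-trans p≤4[1+k+m] (ℕₚ.*-monoʳ-≤ 4 (s≤s (ℕₚ.m≤m+n (k + m) i))))
  between-blocks {i} i<l (inj₂ (3p<8a , _)) =
    ℕₚ.<⇒≱ 3p<8a (ℕₚ.≤-trans (ℕₚ.*-monoʳ-≤ 8 (ℕₚ.+-monoʳ-< (k + m) i<l)) 8[k+m+l]≤3p)

  second-block : ∀ {i} → i < m → InRange p (suc k + m + l + i)
  second-block {i} i<m =
    inj₂ ( ℕₚ.<-≤-trans 3p<8[1+k+m+l] (ℕₚ.*-monoʳ-≤ 8 (s≤s (ℕₚ.m≤m+n (k + m + l) i)))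
         , ℕₚ.≤-<-trans (ℕₚ.*-monoʳ-≤ 2 a≤h) 2h<p )
    where
    a≤h : suc (k + m + l + i) ≤ h
    a≤h = subst (suc (k + m + l + i) ≤_) (sym h≡k+m+l+m) (ℕₚ.+-monoʳ-< (k + m + l) i<m)
    2h<p : 2 * h < p
    2h<p = subst (2 * h <_) (sym p≡1+2h) (s≤s (ℕₚ.≤-reflexive (cong (_+_ h) (ℕₚ.+-identityʳ h))))

  above-half : ∀ i → p < 2 * (suc k + m + l + m + i)
  above-half i = ℕₚ.<-≤-trans (subst (_< 2 * suc h) (sym p≡1+2h) (1+2n<2[1+n] h))
                             (ℕₚ.*-monoʳ-≤ 2 (s≤s (subst (_≤ k + m + l + m + i) (sym h≡k+m+l+m) (ℕₚ.m≤m+n _ i))))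

  above-second-block : ∀ i → ¬ InRange p (suc k + m + l + m + i)
  above-second-block i (inj₁ (_ , 4a<p)) =
    ℕₚ.<⇒≱ 4a<p (ℕₚ.≤-trans (ℕₚ.<⇒≤ (above-half i)) (ℕₚ.*-monoˡ-≤ (suc k + m + l + m + i) (ℕₚ.m≤m+n 2 2)))
  above-second-block i (inj₂ (_ , 2a<p)) = ℕₚ.<-asym 2a<p (above-half i)

  filter-inRange : filter (inRange? p) (upTo p)
                   ≡ applyUpTo (_+_ (suc k)) m ++ applyUpTo (_+_ (suc (k + m + l))) m
  filter-inRange = begin
    filter (inRange? p) (upTo p)
      ≡⟨ cong (filter (inRange? p) ∘ upTo) (trans p≡1+2h (cong (λ t → suc (t + h)) h≡k+m+l+m)) ⟩
    filter (inRange? p) (upTo (suc k + m + l + m + h))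
      ≡⟨ cong (filter (inRange? p)) upTo-split ⟩
    filter (inRange? p) ((((upTo (suc k) ++ B) ++ C) ++ D) ++ E)
      ≡⟨ filter-blocks (inRange? p) (applyUpTo⁺₁ id (suc k) (below-first-block ∘ ℕₚ.≤-pred))
                                    (applyUpTo⁺₁ _ m first-block)
                                    (applyUpTo⁺₁ _ l between-blocks)
                                    (applyUpTo⁺₁ _ m second-block)
                                    (applyUpTo⁺₁ _ h (λ {i} _ → above-second-block i)) ⟩
    B ++ D ∎
    where
    open ≡-Reasoning
    B = applyUpTo (_+_ (suc k)) m
    C = applyUpTo (_+_ (suc k + m)) l
    D = applyUpTo (_+_ (suc k + m + l)) m
    E = applyUpTo (_+_ (suc k + m + l + m)) h
    upTo-split : upTo (suc k + m + l + m + h) ≡ (((upTo (suc k) ++ B) ++ C) ++ D) ++ E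
    upTo-split = begin
      upTo (suc k + m + l + m + h)            ≡⟨ applyUpTo-++ id (suc k + m + l + m) h ⟩
      upTo (suc k + m + l + m) ++ E           ≡⟨ cong (_++ E) (applyUpTo-++ id (suc k + m + l) m) ⟩
      (upTo (suc k + m + l) ++ D) ++ E        ≡⟨ cong (λ t → (t ++ D) ++ E) (applyUpTo-++ id (suc k + m) l) ⟩
      ((upTo (suc k + m) ++ C) ++ D) ++ E     ≡⟨ cong (λ t → ((t ++ C) ++ D) ++ E) (applyUpTo-++ id (suc k) m) ⟩
      (((upTo (suc k) ++ B) ++ C) ++ D) ++ E  ∎

neg1^-#N4 : ∀ {p} .{{_ : NonZero p}} → Prime p → (L : Layout p) →
            ∀ {q c} → Halves q c → q + c ≡ Layout.h L →
            let open Layout L in neg1^ (#N4 p) ≡ neg1^ (m * h + c * (k + m))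
neg1^-#N4 p-prime L q,c q+c≡h =
  trans (cong (neg1^ ∘ #NR) (filter-inRange L)) (neg1^-#NR-blocks q,c q+c≡h halves h≡k+m+l+m)
  where
  open Layout L
  open Euler {h = h} p-prime p≡1+2h using (#NR)
  open BlockProducts {h = h} p-prime p≡1+2h using (neg1^-#NR-blocks)
layout₁ : ∀ k → Layout (1 + 8 * k)
layout₁ k = record
  { h = 4 * k ; k = k ; m = k ; l = k
  ; p≡1+2h        = solve (k ∷ [])
  ; h≡k+m+l+m     = solve (k ∷ [])
  ; halves        = inj₁ refl
  ; 8k≤p          = ≤-slack 1 (solve (k ∷ []))
  ; p<8[1+k]      = ≤-slack 6 (solve (k ∷ []))
  ; 4[k+m]<p      = ≤-slack 0 (solve (k ∷ []))
  ; p≤4[1+k+m]    = ≤-slack 3 (solve (k ∷ []))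
  ; 8[k+m+l]≤3p   = ≤-slack 3 (solve (k ∷ []))
  ; 3p<8[1+k+m+l] = ≤-slack 4 (solve (k ∷ []))
  }

layout₅ : ∀ k → Layout (5 + 8 * k)
layout₅ k = record
  { h = 4 * k + 2 ; k = k ; m = suc k ; l = k
  ; p≡1+2h        = solve (k ∷ [])
  ; h≡k+m+l+m     = solve (k ∷ [])
  ; halves        = inj₂ refl
  ; 8k≤p          = ≤-slack 5 (solve (k ∷ []))
  ; p<8[1+k]      = ≤-slack 2 (solve (k ∷ []))
  ; 4[k+m]<p      = ≤-slack 0 (solve (k ∷ []))
  ; p≤4[1+k+m]    = ≤-slack 3 (solve (k ∷ []))
  ; 8[k+m+l]≤3p   = ≤-slack 7 (solve (k ∷ []))
  ; 3p<8[1+k+m+l] = ≤-slack 0 (solve (k ∷ []))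
  }

layout₃ : ∀ k → Layout (3 + 8 * k)
layout₃ k = record
  { h = 4 * k + 1 ; k = k ; m = k ; l = suc k
  ; p≡1+2h        = solve (k ∷ [])
  ; h≡k+m+l+m     = solve (k ∷ [])
  ; halves        = inj₁ refl
  ; 8k≤p          = ≤-slack 3 (solve (k ∷ []))
  ; p<8[1+k]      = ≤-slack 4 (solve (k ∷ []))
  ; 4[k+m]<p      = ≤-slack 2 (solve (k ∷ []))
  ; p≤4[1+k+m]    = ≤-slack 1 (solve (k ∷ []))
  ; 8[k+m+l]≤3p   = ≤-slack 1 (solve (k ∷ []))
  ; 3p<8[1+k+m+l] = ≤-slack 6 (solve (k ∷ []))
  }

layout₇ : ∀ k → Layout (7 + 8 * k)
layout₇ k = record
  { h = 4 * k + 3 ; k = k ; m = suc k ; l = suc k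
  ; p≡1+2h        = solve (k ∷ [])
  ; h≡k+m+l+m     = solve (k ∷ [])
  ; halves        = inj₂ refl
  ; 8k≤p          = ≤-slack 7 (solve (k ∷ []))
  ; p<8[1+k]      = ≤-slack 0 (solve (k ∷ []))
  ; 4[k+m]<p      = ≤-slack 2 (solve (k ∷ []))
  ; p≤4[1+k+m]    = ≤-slack 1 (solve (k ∷ []))
  ; 8[k+m+l]≤3p   = ≤-slack 5 (solve (k ∷ []))
  ; 3p<8[1+k+m+l] = ≤-slack 2 (solve (k ∷ []))
  }

case₁ : ∀ k → Prime (1 + 8 * k) → neg1^ (#N4 (1 + 8 * k)) ≡ + 1
case₁ k p-prime = trans (neg1^-#N4 p-prime (layout₁ k) {q = 2 * k} (inj₁ refl) q+c≡h)
                        (neg1^-parity (4 * k * k) 0 exponent)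
  where
  q+c≡h : 2 * k + 2 * k ≡ 4 * k
  q+c≡h = solve (k ∷ [])
  exponent : k * (4 * k) + 2 * k * (k + k) ≡ 4 * k * k + 4 * k * k + 0
  exponent = solve (k ∷ [])

case₅ : ∀ k → Prime (5 + 8 * k) → neg1^ (#N4 (5 + 8 * k)) ≡ - (+ 1)
case₅ k p-prime = trans (neg1^-#N4 p-prime (layout₅ k) {q = 2 * k + 1} (inj₁ refl) q+c≡h)
                        (neg1^-parity (4 * k * k + 5 * k + 1) 1 exponent)
  where
  q+c≡h : (2 * k + 1) + (2 * k + 1) ≡ 4 * k + 2
  q+c≡h = solve (k ∷ [])
  exponent : suc k * (4 * k + 2) + (2 * k + 1) * (k + suc k)
             ≡ 4 * k * k + 5 * k + 1 + (4 * k * k + 5 * k + 1) + 1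
  exponent = solve (k ∷ [])

case₃ : ∀ k → Prime (3 + 8 * k) → neg1^ (#N4 (3 + 8 * k)) ≡ neg1^ k
case₃ k p-prime = trans (neg1^-#N4 p-prime (layout₃ k) {q = 2 * k} (inj₂ refl) q+c≡h)
                        (neg1^-parity (4 * k * k + k) k exponent)
  where
  q+c≡h : 2 * k + suc (2 * k) ≡ 4 * k + 1
  q+c≡h = solve (k ∷ [])
  exponent : k * (4 * k + 1) + suc (2 * k) * (k + k) ≡ 4 * k * k + k + (4 * k * k + k) + k
  exponent = solve (k ∷ [])

case₇ : ∀ k → Prime (7 + 8 * k) → neg1^ (#N4 (7 + 8 * k)) ≡ neg1^ (k + 1)
case₇ k p-prime = trans (neg1^-#N4 p-prime (layout₇ k) {q = 2 * k + 1} (inj₂ refl) q+c≡h)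
                        (neg1^-parity (4 * k * k + 6 * k + 2) (k + 1) exponent)
  where
  q+c≡h : (2 * k + 1) + suc (2 * k + 1) ≡ 4 * k + 3
  q+c≡h = solve (k ∷ [])
  exponent : suc k * (4 * k + 3) + suc (2 * k + 1) * (k + suc k)
             ≡ 4 * k * k + 6 * k + 2 + (4 * k * k + 6 * k + 2) + (k + 1)
  exponent = solve (k ∷ [])

theorem4p3 : (p : ℕ) → .{{_ : NonZero p}} → Prime p → 10 < p → (k : ℕ) →
    (p ≡ 1 + 8 * k → neg1^ (#N4 p) ≡ + 1)
    × (p ≡ 5 + 8 * k → neg1^ (#N4 p) ≡ - (+ 1))
    × (p ≡ 3 + 8 * k → neg1^ (#N4 p) ≡ neg1^ k)
    × (p ≡ 7 + 8 * k → neg1^ (#N4 p) ≡ neg1^ (k + 1))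
theorem4p3 p p-prime _ k =
    (λ { refl → case₁ k p-prime })
  , (λ { refl → case₅ k p-prime })
  , (λ { refl → case₃ k p-prime })
  , (λ { refl → case₇ k p-prime })
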